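{- Let $G\in\varepsilon_{01}$ and let $C,C'$ be two cycles of $G$ whose intersection is a path $P_t$ with $t>0$ edges. If both $C,C'$ are of type $0$, or one is of type $0$ and the other of type $1$, then $t$ is even. If both are of type $1$, then $t$ is odd.
   Context: All graphs are finite, simple and connected. An Euler graph is a connected graph all of whose nodes have even degree. A cycle of length $n$ is of type $i$ if $n\equiv i\pmod 4$. $\varepsilon_{01}$ is the class of Euler graphs in which every cycle has length $\equiv 0$ or $\equiv 1\pmod 4$ and which contain at least one cycle of each of the types $0$ and $1$. -}

module Defs where

open import Data.Nat using (ℕ; zero; suc; _≤_; _<_; _%_)
open import Data.Nat.DivMod using (m%n<n)
open import Data.Fin using (Fin; toℕ; fromℕ<; inject₁) renaming (suc to fsuc)
open import Data.Bool using (Bool; true; false; if_then_else_)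
open import Data.List using (List; map; allFin)
open import Data.Nat.ListAction using (sum)
open import Data.Product using (Σ; ∃; _×_; _,_)
open import Data.Sum using (_⊎_)
open import Relation.Binary.PropositionalEquality using (_≡_; _≢_)
open import Relation.Binary.Construct.Closure.ReflexiveTransitive using (Star)
open import Function.Definitions using (Injective)

record Graph (n : ℕ) : Set where
  field
    adj   : Fin n → Fin n → Bool
    sym   : ∀ u v → adj u v ≡ adj v u
    irref : ∀ u → adj u u ≡ false

module _ {n : ℕ} (G : Graph n) where
  open Graph G

  Edge : Fin n → Fin n → Set
  Edge u v = adj u v ≡ true

  Connected : Set
  Connected = ∀ u v → Star Edge u v

  degree : Fin n → ℕ
  degree u = sum (map (λ v → if adj u v then 1 else 0) (allFin n))

  Euler : Set
  Euler = Connected × (∀ u → degree u % 2 ≡ 0)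

  next : ∀ {m} → Fin (suc m) → Fin (suc m)
  next {m} i = fromℕ< (m%n<n (suc (toℕ i)) (suc m))

  record Cycle : Set where
    field
      m    : ℕ
      len3 : 3 ≤ suc m
      vs   : Fin (suc m) → Fin n
      inj  : Injective _≡_ _≡_ vs
      adjc : ∀ i → Edge (vs i) (vs (next i))

    length : ℕ
    length = suc m

    OnV : Fin n → Set
    OnV x = ∃ λ i → vs i ≡ x

    OnE : Fin n → Fin n → Set
    OnE x y = ∃ λ i → (vs i ≡ x × vs (next i) ≡ y) ⊎ (vs i ≡ y × vs (next i) ≡ x)

  open Cycle public

  OfType : ℕ → Cycle → Set
  OfType i C = length C % 4 ≡ i

  Eps01 : Set
  Eps01 = Euler
        × (∀ C → OfType 0 C ⊎ OfType 1 C)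
        × (∃ λ C → OfType 0 C)
        × (∃ λ C → OfType 1 C)

  IntersectionIsPath : Cycle → Cycle → ℕ → Set
  IntersectionIsPath C C' t =
    Σ (Fin (suc t) → Fin n) λ p →
      Injective _≡_ _≡_ p
      × (∀ x → (OnV C x × OnV C' x) → ∃ λ i → p i ≡ x)
      × (∀ x → (∃ λ i → p i ≡ x) → OnV C x × OnV C' x)
      × (∀ x y → (OnE C x y × OnE C' x y) → PathEdge p x y)
      × (∀ x y → PathEdge p x y → OnE C x y × OnE C' x y)
    where
      PathEdge : (Fin (suc t) → Fin n) → Fin n → Fin n → Set
      PathEdge p x y = ∃ λ (i : Fin t) →
        (p (inject₁ i) ≡ x × p (fsuc i) ≡ y) ⊎ (p (inject₁ i) ≡ y × p (fsuc i) ≡ x)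

module Submission where

-- Align both cycles along the common path P = p₀ … pₜ. Then C is P followed by an arc of
-- length a = |C| − t from pₜ back to p₀, and C′ is P followed by an arc of length b = |C′| − t.
-- As C ∩ C′ is exactly P, the two arcs meet only at p₀ and pₜ, so together they form a cycle
-- of length a + b, which has type 0 or 1. Reducing |C| + |C′| = 2t + (a + b) modulo 4 then
-- fixes the parity of t.

open import Defs
open import Data.Nat
  using (ℕ; zero; suc; pred; _+_; _*_; _∸_; _<_; _≤_; _%_; z≤n; s≤s; z<s; _≤?_; NonZero)
open import Data.Nat.Properties
open import Data.Nat.DivMod
  using ( _/_; _mod_; m%n<n; m<n⇒m%n≡m; n%n≡0; m%n%n≡m%n; [m+n]%n≡m%n; [m+kn]%n≡m%n
        ; m≡m%n+[m/n]*n; %-distribˡ-+)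
open import Data.Nat.Tactic.RingSolver using (solve-∀)
open import Data.Fin using (Fin; toℕ; fromℕ<; inject₁) renaming (zero to fzero; suc to fsuc)
open import Data.Fin.Properties
  using (toℕ-injective; toℕ-fromℕ<; fromℕ<-cong; fromℕ<-toℕ; toℕ<n; toℕ-inject₁)
open import Data.Product using (Σ; ∃; ∃₂; _×_; _,_; proj₁; proj₂)
open import Data.Sum using (_⊎_; inj₁; inj₂)
open import Data.Empty using (⊥-elim)
open import Relation.Nullary using (yes; no)
open import Relation.Binary.PropositionalEquality
open import Function using (_∘_)

open ≡-Reasoning

[m+n%o]%o≡[m+n]%o : ∀ m n o .{{_ : NonZero o}} → (m + n % o) % o ≡ (m + n) % o
[m+n%o]%o≡[m+n]%o m n o = begin
  (m + n % o) % o         ≡⟨ %-distribˡ-+ m (n % o) o ⟩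
  (m % o + n % o % o) % o ≡⟨ cong (λ r → (m % o + r) % o) (m%n%n≡m%n n o) ⟩
  (m % o + n % o) % o     ≡⟨ %-distribˡ-+ m n o ⟨
  (m + n) % o             ∎

[o∸m+[m+n]%o]%o≡n%o : ∀ {m} n o .{{_ : NonZero o}} → m ≤ o → (o ∸ m + (m + n) % o) % o ≡ n % o
[o∸m+[m+n]%o]%o≡n%o {m} n o m≤o = begin
  (o ∸ m + (m + n) % o) % o ≡⟨ [m+n%o]%o≡[m+n]%o (o ∸ m) (m + n) o ⟩
  (o ∸ m + (m + n)) % o     ≡⟨ cong (_% o) (+-assoc (o ∸ m) m n) ⟨
  (o ∸ m + m + n) % o       ≡⟨ cong (λ r → (r + n) % o) (m∸n+n≡m m≤o) ⟩
  (o + n) % o               ≡⟨ cong (_% o) (+-comm o n) ⟩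
  (n + o) % o               ≡⟨ [m+n]%n≡m%n n o ⟩
  n % o                     ∎

[m+[o∸m+n]%o]%o≡n%o : ∀ {m} n o .{{_ : NonZero o}} → m ≤ o → (m + (o ∸ m + n) % o) % o ≡ n % o
[m+[o∸m+n]%o]%o≡n%o {m} n o m≤o = begin
  (m + (o ∸ m + n) % o) % o ≡⟨ [m+n%o]%o≡[m+n]%o m (o ∸ m + n) o ⟩
  (m + (o ∸ m + n)) % o     ≡⟨ cong (_% o) (+-assoc m (o ∸ m) n) ⟨
  (m + (o ∸ m) + n) % o     ≡⟨ cong (λ r → (r + n) % o) (m+[n∸m]≡n m≤o) ⟩
  (o + n) % o               ≡⟨ cong (_% o) (+-comm o n) ⟩
  (n + o) % o               ≡⟨ [m+n]%n≡m%n n o ⟩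
  n % o                     ∎

[m+_]%o-injective : ∀ {m i j} o .{{_ : NonZero o}} → m ≤ o → i < o → j < o →
                    (m + i) % o ≡ (m + j) % o → i ≡ j
[m+_]%o-injective {m} {i} {j} o m≤o i<o j<o eq = begin
  i                         ≡⟨ m<n⇒m%n≡m i<o ⟨
  i % o                     ≡⟨ [o∸m+[m+n]%o]%o≡n%o i o m≤o ⟨
  (o ∸ m + (m + i) % o) % o ≡⟨ cong (λ r → (o ∸ m + r) % o) eq ⟩
  (o ∸ m + (m + j) % o) % o ≡⟨ [o∸m+[m+n]%o]%o≡n%o j o m≤o ⟩
  j % o                     ≡⟨ m<n⇒m%n≡m j<o ⟩
  j                         ∎

mod-cong : ∀ a b {L} → a % suc L ≡ b % suc L → a mod suc L ≡ b mod suc L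
mod-cong a b e = fromℕ<-cong _ _ e _ _

toℕ-mod : ∀ {L} (i : Fin (suc L)) → toℕ i mod suc L ≡ i
toℕ-mod i = trans (fromℕ<-cong _ _ (m<n⇒m%n≡m (toℕ<n i)) _ (toℕ<n i))
                  (fromℕ<-toℕ i (toℕ<n i))

m+n<3⇒m≡1∧n≡1 : ∀ {m n} → 0 < m → 0 < n → m + n < 3 → m ≡ 1 × n ≡ 1
m+n<3⇒m≡1∧n≡1 {1} {1} _ _ _ = refl , refl
m+n<3⇒m≡1∧n≡1 {1} {suc (suc _)} _ _ (s≤s (s≤s (s≤s ())))
m+n<3⇒m≡1∧n≡1 {suc (suc _)} {suc _} _ _ m+n<3 =
  ⊥-elim (<⇒≱ m+n<3 (+-mono-≤ (s≤s (s≤s z≤n)) (s≤s z≤n)))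

SameEnds : ∀ {A : Set} → A → A → A → A → Set
SameEnds u v x y = (u ≡ x × v ≡ y) ⊎ (u ≡ y × v ≡ x)

SameEnds-swapˡ : ∀ {A : Set} {u v x y : A} → SameEnds u v x y → SameEnds v u x y
SameEnds-swapˡ (inj₁ (u≡x , v≡y)) = inj₂ (v≡y , u≡x)
SameEnds-swapˡ (inj₂ (u≡y , v≡x)) = inj₁ (v≡x , u≡y)

SameEnds-swapʳ : ∀ {A : Set} {u v x y : A} → SameEnds u v x y → SameEnds u v y x
SameEnds-swapʳ (inj₁ p) = inj₂ p
SameEnds-swapʳ (inj₂ p) = inj₁ p

SameEnds-cong : ∀ {A : Set} {u u′ v v′ x y : A} → u ≡ u′ → v ≡ v′ →
                SameEnds u v x y → SameEnds u′ v′ x y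
SameEnds-cong refl refl s = s

module _ {n : ℕ} {G : Graph n} where

  Edge-sym : ∀ {x y} → Edge G x y → Edge G y x
  Edge-sym {x} {y} e = trans (Graph.sym G y x) e

  module _ {C : Cycle G} where

    OnE-sym : ∀ {x y} → OnE C x y → OnE C y x
    OnE-sym (i , s) = i , SameEnds-swapʳ s

    OnE⇒Edge : ∀ {x y} → OnE C x y → Edge G x y
    OnE⇒Edge (i , inj₁ (refl , refl)) = adjc C i
    OnE⇒Edge (i , inj₂ (refl , refl)) = Edge-sym (adjc C i)

    OnE⇒OnV : ∀ {x y} → OnE C x y → OnV C x
    OnE⇒OnV (i , inj₁ (vsᵢ≡x , _)) = i , vsᵢ≡x
    OnE⇒OnV (i , inj₂ (_ , vsₙ≡x)) = next G i , vsₙ≡x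

  record Path (R : Fin n → Fin n → Set) (ℓ : ℕ) : Set where
    field
      vertex    : ℕ → Fin n
      injective : ∀ {i j} → i ≤ ℓ → j ≤ ℓ → vertex i ≡ vertex j → i ≡ j
      step      : ∀ {k} → k < ℓ → R (vertex k) (vertex (suc k))

  Path-map : ∀ {R S ℓ} → (∀ {x y} → R x y → S x y) → Path R ℓ → Path S ℓ
  Path-map f p = record { Path p ; step = λ k<ℓ → f (Path.step p k<ℓ) }

  record Traversal (C : Cycle G) : Set where
    field
      vertex    : ℕ → Fin n
      injective : ∀ {i j} → i < length C → j < length C → vertex i ≡ vertex j → i ≡ j
      closed    : vertex (length C) ≡ vertex 0
      on-cycle  : ∀ k → OnV C (vertex k)
      step      : ∀ {k} → k < length C → OnE C (vertex k) (vertex (suc k))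
      covers    : ∀ {x y} → OnE C x y →
                  ∃ λ k → k < length C × SameEnds (vertex k) (vertex (suc k)) x y

    injective⁺ : ∀ {i j} → 0 < i → 0 < j → i ≤ length C → j ≤ length C →
                 vertex i ≡ vertex j → i ≡ j
    injective⁺ {i} {j} 0<i 0<j i≤L j≤L e with m≤n⇒m<n∨m≡n i≤L | m≤n⇒m<n∨m≡n j≤L
    ... | inj₁ i<L  | inj₁ j<L  = injective i<L j<L e
    ... | inj₁ i<L  | inj₂ refl = ⊥-elim (<⇒≢ 0<i (sym (injective i<L 0<L (trans e closed))))
      where
        0<L : 0 < length C
        0<L = ≤-<-trans z≤n j≤L
    ... | inj₂ refl | inj₁ j<L  = ⊥-elim (<⇒≢ 0<j (sym (injective j<L 0<L (trans (sym e) closed))))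
      where
        0<L : 0 < length C
        0<L = ≤-<-trans z≤n i≤L
    ... | inj₂ refl | inj₂ refl = refl

    neighbour : ∀ {k x} → 0 < k → k < length C → OnE C (vertex k) x →
                x ≡ vertex (suc k) ⊎ x ≡ vertex (pred k)
    neighbour {k} 0<k k<L e with covers e
    ... | j , j<L , inj₁ (vⱼ≡vₖ , vⱼ₊₁≡x) =
      inj₁ (trans (sym vⱼ₊₁≡x) (cong (vertex ∘ suc) (injective j<L k<L vⱼ≡vₖ)))
    ... | j , j<L , inj₂ (vⱼ≡x , vⱼ₊₁≡vₖ) =
      inj₂ (trans (sym vⱼ≡x) (cong (vertex ∘ pred) (injective⁺ z<s 0<k j<L (<⇒≤ k<L) vⱼ₊₁≡vₖ)))

    closing-step : ∀ {k} → suc k ≡ length C → OnE C (vertex k) (vertex 0)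
    closing-step {k} refl = subst (OnE C (vertex k)) closed (step ≤-refl)

    -- A window s … s + ℓ never contains both indices 0 and length C of the start vertex.
    injective-window : ∀ {s ℓ i j} → ℓ < length C → s + ℓ ≤ length C → i ≤ ℓ → j ≤ ℓ →
                       vertex (s + i) ≡ vertex (s + j) → i ≡ j
    injective-window {zero} ℓ<L _ i≤ℓ j≤ℓ = injective (≤-<-trans i≤ℓ ℓ<L) (≤-<-trans j≤ℓ ℓ<L)
    injective-window {suc s} _ s+ℓ≤L i≤ℓ j≤ℓ e = +-cancelˡ-≡ (suc s) _ _
      (injective⁺ z<s z<s (≤-trans (+-monoʳ-≤ (suc s) i≤ℓ) s+ℓ≤L)
                          (≤-trans (+-monoʳ-≤ (suc s) j≤ℓ) s+ℓ≤L) e)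

    arc : ∀ s ℓ → ℓ < length C → s + ℓ ≤ length C → Path (OnE C) ℓ
    arc s ℓ ℓ<L s+ℓ≤L = record
      { vertex    = λ k → vertex (s + k)
      ; injective = injective-window ℓ<L s+ℓ≤L
      ; step      = λ {k} k<ℓ → subst (OnE C (vertex (s + k)) ∘ vertex) (sym (+-suc s k))
                                  (step (<-≤-trans (+-monoʳ-< s k<ℓ) s+ℓ≤L))
      }

  open Traversal

  module _ (C : Cycle G) (i₀ : Fin (length C)) where
    private
      L : ℕ
      L = length C

      position : ℕ → Fin L
      position k = (toℕ i₀ + k) mod L

      position-suc : ∀ k → next G (position k) ≡ position (suc k)
      position-suc k = mod-cong (suc (toℕ (position k))) (toℕ i₀ + suc k) (begin
        suc (toℕ (position k)) % L  ≡⟨ cong (λ r → suc r % L) (toℕ-fromℕ< _) ⟩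
        (1 + (toℕ i₀ + k) % L) % L  ≡⟨ [m+n%o]%o≡[m+n]%o 1 (toℕ i₀ + k) L ⟩
        suc (toℕ i₀ + k) % L        ≡⟨ cong (_% L) (+-suc (toℕ i₀) k) ⟨
        (toℕ i₀ + suc k) % L        ∎)

      index-of : Fin L → ℕ
      index-of j = (L ∸ toℕ i₀ + toℕ j) % L

      position-index-of : ∀ j → position (index-of j) ≡ j
      position-index-of j =
        trans (mod-cong (toℕ i₀ + index-of j) (toℕ j) ([m+[o∸m+n]%o]%o≡n%o (toℕ j) L (<⇒≤ (toℕ<n i₀))))
              (toℕ-mod j)

    rotation : Traversal C
    rotation = record
      { vertex    = vs C ∘ position
      ; injective = λ i<L j<L e → [m+_]%o-injective L (<⇒≤ (toℕ<n i₀)) i<L j<L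
                      (trans (sym (toℕ-fromℕ< _)) (trans (cong toℕ (inj C e)) (toℕ-fromℕ< _)))
      ; closed    = cong (vs C) (mod-cong (toℕ i₀ + L) (toℕ i₀ + 0)
                      (trans ([m+n]%n≡m%n (toℕ i₀) L) (cong (_% L) (sym (+-identityʳ (toℕ i₀))))))
      ; on-cycle  = λ k → position k , refl
      ; step      = λ {k} _ → position k , inj₁ (refl , cong (vs C) (position-suc k))
      ; covers    = λ { (j , s) → index-of j , m%n<n (L ∸ toℕ i₀ + toℕ j) L ,
                        SameEnds-cong (sym (cong (vs C) (position-index-of j)))
                                      (sym (cong (vs C) (trans (sym (position-suc (index-of j)))
                                                               (cong (next G) (position-index-of j))))) s }
      }

    rotation-start : vertex rotation 0 ≡ vs C i₀
    rotation-start = cong (vs C) (trans (mod-cong (toℕ i₀ + 0) (toℕ i₀) (cong (_% L) (+-identityʳ (toℕ i₀))))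
                                        (toℕ-mod i₀))

  module _ {C : Cycle G} (w : Traversal C) where
    private
      L : ℕ
      L = length C

      L∸[1+k]<L : ∀ {k} → k < L → L ∸ suc k < L
      L∸[1+k]<L k<L = ∸-monoʳ-< z<s k<L

      1+[L∸[1+k]]≡L∸k : ∀ {k} → k < L → suc (L ∸ suc k) ≡ L ∸ k
      1+[L∸[1+k]]≡L∸k k<L = sym (+-∸-assoc 1 k<L)

    reverse : Traversal C
    reverse = record
      { vertex    = λ k → vertex w (L ∸ k)
      ; injective = λ {i} {j} i<L j<L e → ∸-cancelˡ-≡ (<⇒≤ i<L) (<⇒≤ j<L)
                      (injective⁺ w (m<n⇒0<n∸m i<L) (m<n⇒0<n∸m j<L) (m∸n≤m L i) (m∸n≤m L j) e)
      ; closed    = trans (cong (vertex w) (n∸n≡0 L)) (sym (closed w))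
      ; on-cycle  = λ k → on-cycle w (L ∸ k)
      ; step      = λ {k} k<L → OnE-sym {C = C}
                      (subst (OnE C (vertex w (L ∸ suc k)) ∘ vertex w) (1+[L∸[1+k]]≡L∸k k<L)
                             (step w (L∸[1+k]<L k<L)))
      ; covers    = reverse-covers
      }
      where
        reverse-covers : ∀ {x y} → OnE C x y →
                         ∃ λ k → k < L × SameEnds (vertex w (L ∸ k)) (vertex w (L ∸ suc k)) x y
        reverse-covers e with covers w e
        ... | k , k<L , s = L ∸ suc k , L∸[1+k]<L k<L ,
          SameEnds-cong (cong (vertex w) (sym (m∸[m∸n]≡n k<L)))
                        (cong (vertex w) (sym (trans (cong (L ∸_) (1+[L∸[1+k]]≡L∸k k<L))
                                                     (m∸[m∸n]≡n (<⇒≤ k<L)))))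
                        (SameEnds-swapˡ s)

  orient : ∀ {C : Cycle G} {x y} (w : Traversal C) → vertex w 0 ≡ x → OnE C x y →
           Σ (Traversal C) λ w′ → vertex w′ 0 ≡ x × vertex w′ 1 ≡ y
  orient {C} {x} {y} w v₀≡x e with covers w e
  ... | k , k<L , inj₁ (vₖ≡x , vₖ₊₁≡y) = w , v₀≡x , subst (λ j → vertex w (suc j) ≡ y) k≡0 vₖ₊₁≡y
    where
      k≡0 : k ≡ 0
      k≡0 = injective w k<L (≤-trans (s≤s z≤n) (len3 C)) (trans vₖ≡x (sym v₀≡x))
  ... | k , k<L , inj₂ (vₖ≡y , vₖ₊₁≡x) =
    reverse w , trans (closed w) v₀≡x , subst (λ j → vertex w (pred j) ≡ y) k+1≡L vₖ≡y
    where
      k+1≡L : suc k ≡ length C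
      k+1≡L = injective⁺ w z<s (≤-trans (s≤s z≤n) (len3 C)) k<L ≤-refl
                (trans vₖ₊₁≡x (trans (sym v₀≡x) (sym (closed w))))

  traversal-through : ∀ {C : Cycle G} {x y} → OnE C x y →
                      Σ (Traversal C) λ w → vertex w 0 ≡ x × vertex w 1 ≡ y
  traversal-through {C} e with OnE⇒OnV {C = C} e
  ... | i , vsᵢ≡x = orient (rotation C i) (trans (rotation-start C i) vsᵢ≡x) e

  align : ∀ {C : Cycle G} {t} → 0 < t → (P : Path (OnE C) t) →
          Σ (Traversal C) λ w → t < length C × (∀ {k} → k ≤ t → vertex w k ≡ Path.vertex P k)
  align {C} {t} 0<t P with traversal-through (Path.step P 0<t)
  ... | w , v₀≡p₀ , v₁≡p₁ = w , proj₁ (agrees-upto ≤-refl) , proj₂ ∘ agrees-upto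
    where
      open Path P renaming (vertex to p; injective to p-injective; step to p-step)

      Agrees : ℕ → Set
      Agrees k = k ≤ t → k < length C × vertex w k ≡ p k

      -- pₖ₊₂ is a C-neighbour of pₖ₊₁ = vertex w (k + 1) other than pₖ = vertex w k.
      extend : ∀ {k} → Agrees k → Agrees (suc k) → Agrees (suc (suc k))
      extend {k} agreeₖ agreeₖ₊₁ k+2≤t with agreeₖ (<⇒≤ (<⇒≤ k+2≤t)) | agreeₖ₊₁ (<⇒≤ k+2≤t)
      ... | _ , vₖ≡pₖ | k+1<L , vₖ₊₁≡pₖ₊₁
        with neighbour w z<s k+1<L (subst (λ v → OnE C v (p (suc (suc k)))) (sym vₖ₊₁≡pₖ₊₁)
                                          (p-step k+2≤t))
      ... | inj₂ pₖ₊₂≡vₖ =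
        ⊥-elim (m≢1+n+m k (p-injective (<⇒≤ (<⇒≤ k+2≤t)) k+2≤t (trans (sym vₖ≡pₖ) (sym pₖ₊₂≡vₖ))))
      ... | inj₁ pₖ₊₂≡vₖ₊₂ with m≤n⇒m<n∨m≡n k+1<L
      ...   | inj₁ k+2<L = k+2<L , sym pₖ₊₂≡vₖ₊₂
      ...   | inj₂ k+2≡L = ⊥-elim (1+n≢0 (p-injective k+2≤t z≤n
                (trans pₖ₊₂≡vₖ₊₂ (trans (cong (vertex w) k+2≡L) (trans (closed w) v₀≡p₀)))))

      agrees-pair : ∀ k → Agrees k × Agrees (suc k)
      agrees-pair zero    = (λ _ → ≤-trans (s≤s z≤n) (len3 C) , v₀≡p₀)
                          , (λ _ → ≤-trans (s≤s (s≤s z≤n)) (len3 C) , v₁≡p₁)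
      agrees-pair (suc k) = let agreeₖ , agreeₖ₊₁ = agrees-pair k in agreeₖ₊₁ , extend agreeₖ agreeₖ₊₁

      agrees-upto : ∀ {k} → Agrees k
      agrees-upto {k} = proj₁ (agrees-pair k)

  closed-walk-cycle : ∀ N → 3 ≤ N → (f : ℕ → Fin n) →
                      (∀ {i j} → i < N → j < N → f i ≡ f j → i ≡ j) →
                      (∀ {k} → k < N → Edge G (f k) (f (suc k))) → f N ≡ f 0 →
                      Σ (Cycle G) λ D → length D ≡ N
  closed-walk-cycle (suc N) 3≤N f f-injective f-step f-closed =
    record { m = N ; len3 = 3≤N ; vs = f ∘ toℕ
           ; inj = λ {i} {j} e → toℕ-injective (f-injective (toℕ<n i) (toℕ<n j) e)
           ; adjc = λ i → subst (Edge G (f (toℕ i))) (sym (f-wraps (toℕ<n i))) (f-step (toℕ<n i)) } , refl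
    where
      f-wraps : ∀ {k} → k < suc N → f (toℕ (suc k mod suc N)) ≡ f (suc k)
      f-wraps {k} k<N with m≤n⇒m<n∨m≡n k<N
      ... | inj₁ k+1<N = cong f (trans (toℕ-fromℕ< _) (m<n⇒m%n≡m k+1<N))
      ... | inj₂ k+1≡N = begin
        f (toℕ (suc k mod suc N)) ≡⟨ cong f (toℕ-fromℕ< _) ⟩
        f (suc k % suc N)         ≡⟨ cong (λ r → f (r % suc N)) k+1≡N ⟩
        f (suc N % suc N)         ≡⟨ cong f (n%n≡0 (suc N)) ⟩
        f 0                       ≡⟨ f-closed ⟨
        f (suc N)                 ≡⟨ cong f k+1≡N ⟨
        f (suc k)                 ∎

  module Glue {a b} (p : Path (Edge G) a) (q : Path (Edge G) b)
              (meet : Path.vertex p a ≡ Path.vertex q 0) where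
    private
      module p = Path p
      module q = Path q

      ∸a<b : ∀ {k} → k < a + b → a ≤ k → k ∸ a < b
      ∸a<b {k} k<a+b a≤k = subst (k ∸ a <_) (m+n∸m≡n a b) (∸-monoˡ-< k<a+b a≤k)

    glue : ℕ → Fin n
    glue k with k ≤? a
    ... | yes _ = p.vertex k
    ... | no _  = q.vertex (k ∸ a)

    glue-p : ∀ {k} → k ≤ a → glue k ≡ p.vertex k
    glue-p {k} k≤a with k ≤? a
    ... | yes _   = refl
    ... | no  k≰a = ⊥-elim (k≰a k≤a)

    glue-q : ∀ {k} → a ≤ k → glue k ≡ q.vertex (k ∸ a)
    glue-q {k} a≤k with k ≤? a
    ... | no _    = refl
    ... | yes k≤a with ≤-antisym k≤a a≤k
    ...   | refl = trans meet (cong q.vertex (sym (n∸n≡0 a)))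

    glue-step : ∀ {k} → k < a + b → Edge G (glue k) (glue (suc k))
    glue-step {k} k<a+b with <-≤-connex k a
    ... | inj₁ k<a = subst₂ (Edge G) (sym (glue-p (<⇒≤ k<a))) (sym (glue-p k<a)) (p.step k<a)
    ... | inj₂ a≤k = subst₂ (Edge G) (sym (glue-q a≤k))
                      (sym (trans (glue-q (≤-trans a≤k (n≤1+n k))) (cong q.vertex (+-∸-assoc 1 a≤k))))
                      (q.step (∸a<b k<a+b a≤k))

    Avoids : Set
    Avoids = ∀ {i j} → i ≤ a → 0 < j → j < b → p.vertex i ≢ q.vertex j

    glue-crossing : Avoids → ∀ {i j} → i ≤ a → a < j → j < a + b → glue i ≢ glue j
    glue-crossing avoids i≤a a<j j<a+b e = avoids i≤a (m<n⇒0<n∸m a<j) (∸a<b j<a+b (<⇒≤ a<j))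
                                             (trans (sym (glue-p i≤a)) (trans e (glue-q (<⇒≤ a<j))))

    glue-injective : Avoids → ∀ {i j} → i < a + b → j < a + b → glue i ≡ glue j → i ≡ j
    glue-injective avoids {i} {j} i<a+b j<a+b e with ≤-<-connex i a | ≤-<-connex j a
    ... | inj₁ i≤a | inj₁ j≤a = p.injective i≤a j≤a (trans (sym (glue-p i≤a)) (trans e (glue-p j≤a)))
    ... | inj₁ i≤a | inj₂ a<j = ⊥-elim (glue-crossing avoids i≤a a<j j<a+b e)
    ... | inj₂ a<i | inj₁ j≤a = ⊥-elim (glue-crossing avoids j≤a a<i i<a+b (sym e))
    ... | inj₂ a<i | inj₂ a<j = ∸-cancelʳ-≡ (<⇒≤ a<i) (<⇒≤ a<j)
          (q.injective (<⇒≤ (∸a<b i<a+b (<⇒≤ a<i))) (<⇒≤ (∸a<b j<a+b (<⇒≤ a<j)))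
                       (trans (sym (glue-q (<⇒≤ a<i))) (trans e (glue-q (<⇒≤ a<j)))))

  glue-cycle : ∀ {a b} (p : Path (Edge G) a) (q : Path (Edge G) b) → 3 ≤ a + b →
               Path.vertex p a ≡ Path.vertex q 0 → Path.vertex q b ≡ Path.vertex p 0 →
               (∀ {i j} → i ≤ a → 0 < j → j < b → Path.vertex p i ≢ Path.vertex q j) →
               Σ (Cycle G) λ D → length D ≡ a + b
  glue-cycle {a} {b} p q 3≤a+b meet close avoids =
    closed-walk-cycle (a + b) 3≤a+b glue (glue-injective avoids) glue-step glue-closed
    where
      open Glue p q meet

      glue-closed : glue (a + b) ≡ glue 0
      glue-closed = trans (glue-q (m≤m+n a b))
                      (trans (cong (Path.vertex q) (m+n∸m≡n a b)) (trans close (sym (glue-p z≤n))))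

  record PathIntersection (C C′ : Cycle G) (t : ℕ) : Set where
    field
      path          : Path (λ x y → OnE C x y × OnE C′ x y) t
      common-vertex : ∀ {x} → OnV C x → OnV C′ x → ∃ λ i → i ≤ t × Path.vertex path i ≡ x
      common-edge   : ∀ {x y} → OnE C x y → OnE C′ x y →
                      ∃ λ i → i < t × SameEnds (Path.vertex path i) (Path.vertex path (suc i)) x y

    open Path path using () renaming (vertex to p; injective to p-injective)

    closing-edge : OnE C (p t) (p 0) → OnE C′ (p t) (p 0) → t ≡ 1
    closing-edge e e′ with common-edge e e′
    ... | i , i<t , inj₁ (pᵢ≡pₜ , _) = ⊥-elim (<⇒≢ i<t (p-injective (<⇒≤ i<t) ≤-refl pᵢ≡pₜ))
    ... | i , i<t , inj₂ (pᵢ≡p₀ , pᵢ₊₁≡pₜ) =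
      trans (sym (p-injective i<t ≤-refl pᵢ₊₁≡pₜ)) (cong suc (p-injective (<⇒≤ i<t) z≤n pᵢ≡p₀))

  -- The arc of C from pₜ forward to p₀, followed by the arc of C′ from p₀ back to pₜ.
  module Splice {C C′ : Cycle G} {t} (0<t : 0 < t) (I : PathIntersection C C′ t)
                (w : Traversal C) (t<L : t < length C)
                (w≡p : ∀ {k} → k ≤ t → vertex w k ≡ Path.vertex (PathIntersection.path I) k)
                (w′ : Traversal C′) (t<L′ : t < length C′)
                (w′≡p : ∀ {k} → k ≤ t → vertex w′ k ≡ Path.vertex (PathIntersection.path I) k) where
    open PathIntersection I using (common-vertex; closing-edge)
    open Path (PathIntersection.path I) using () renaming (vertex to p)

    L L′ a b : ℕ
    L  = length C
    L′ = length C′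
    a  = L ∸ t
    b  = L′ ∸ t

    t+a≡L : t + a ≡ L
    t+a≡L = m+[n∸m]≡n (<⇒≤ t<L)

    t+b≡L′ : t + b ≡ L′
    t+b≡L′ = m+[n∸m]≡n (<⇒≤ t<L′)

    b<L′ : b < L′
    b<L′ = ∸-monoʳ-< 0<t (<⇒≤ t<L′)

    arc-of-C : Path (Edge G) a
    arc-of-C = Path-map (OnE⇒Edge {C = C}) (arc w t a (∸-monoʳ-< 0<t (<⇒≤ t<L)) (≤-reflexive t+a≡L))

    arc-of-C′ : Path (Edge G) b
    arc-of-C′ = Path-map (OnE⇒Edge {C = C′}) (arc (reverse w′) 0 b b<L′ (<⇒≤ b<L′))

    arcs-meet : vertex w (t + a) ≡ vertex w′ (L′ ∸ 0)
    arcs-meet = begin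
      vertex w (t + a) ≡⟨ cong (vertex w) t+a≡L ⟩
      vertex w L       ≡⟨ closed w ⟩
      vertex w 0       ≡⟨ w≡p z≤n ⟩
      p 0              ≡⟨ w′≡p z≤n ⟨
      vertex w′ 0      ≡⟨ closed w′ ⟨
      vertex w′ L′     ∎

    arcs-close : vertex w′ (L′ ∸ b) ≡ vertex w (t + 0)
    arcs-close = begin
      vertex w′ (L′ ∸ b) ≡⟨ cong (vertex w′) (m∸[m∸n]≡n (<⇒≤ t<L′)) ⟩
      vertex w′ t        ≡⟨ w′≡p ≤-refl ⟩
      p t                ≡⟨ w≡p ≤-refl ⟨
      vertex w t         ≡⟨ cong (vertex w) (+-identityʳ t) ⟨
      vertex w (t + 0)   ∎

    arcs-avoid : ∀ {i j} → i ≤ a → 0 < j → j < b → vertex w (t + i) ≢ vertex w′ (L′ ∸ j)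
    arcs-avoid {i} {j} _ 0<j j<b e
      with common-vertex (subst (OnV C) e (on-cycle w (t + i))) (on-cycle w′ (L′ ∸ j))
    ... | c , c≤t , pc≡x = <⇒≱ t<L′∸j (≤-trans (≤-reflexive (sym c≡L′∸j)) c≤t)
      where
        j≤L′ : j ≤ L′
        j≤L′ = ≤-trans (<⇒≤ j<b) (<⇒≤ b<L′)
        c≡L′∸j : c ≡ L′ ∸ j
        c≡L′∸j = injective w′ (≤-<-trans c≤t t<L′) (∸-monoʳ-< 0<j j≤L′) (trans (w′≡p c≤t) pc≡x)
        t<L′∸j : t < L′ ∸ j
        t<L′∸j = subst (_< L′ ∸ j) (m∸[m∸n]≡n (<⇒≤ t<L′)) (∸-monoʳ-< j<b (<⇒≤ b<L′))

    closing : ∀ {D} (v : Traversal D) → (∀ {k} → k ≤ t → vertex v k ≡ p k) → t + 1 ≡ length D →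
              OnE D (p t) (p 0)
    closing {D} v v≡p t+1≡len =
      subst₂ (OnE D) (v≡p ≤-refl) (v≡p z≤n) (closing-step v (trans (+-comm 1 t) t+1≡len))

    -- If a = b = 1, the edge pₜp₀ lies on both cycles, so t = 1 and C would have length 2.
    3≤a+b : 3 ≤ a + b
    3≤a+b with 3 ≤? a + b
    ... | yes 3≤a+b = 3≤a+b
    ... | no  3≰a+b with m+n<3⇒m≡1∧n≡1 (m<n⇒0<n∸m t<L) (m<n⇒0<n∸m t<L′) (≰⇒> 3≰a+b)
    ...   | a≡1 , b≡1 = ⊥-elim (<⇒≱ (len3 C) (≤-reflexive L≡2))
      where
        t≡1 : t ≡ 1
        t≡1 = closing-edge (closing w w≡p (trans (cong (t +_) (sym a≡1)) t+a≡L))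
                           (closing w′ w′≡p (trans (cong (t +_) (sym b≡1)) t+b≡L′))
        L≡2 : L ≡ 2
        L≡2 = trans (sym t+a≡L) (cong₂ _+_ t≡1 a≡1)

    cycle : Σ (Cycle G) λ D → length D ≡ a + b
    cycle = glue-cycle arc-of-C arc-of-C′ 3≤a+b arcs-meet arcs-close arcs-avoid

  complementary-cycle : ∀ {C C′ : Cycle G} {t} → 0 < t → PathIntersection C C′ t →
                        ∃₂ λ a b → length C ≡ t + a × length C′ ≡ t + b
                                 × Σ (Cycle G) λ D → length D ≡ a + b
  complementary-cycle 0<t I
    with align 0<t (Path-map proj₁ (PathIntersection.path I))
       | align 0<t (Path-map proj₂ (PathIntersection.path I))
  ... | w , t<L , w≡p | w′ , t<L′ , w′≡p = a , b , sym t+a≡L , sym t+b≡L′ , cycle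
    where open Splice 0<t I w t<L w≡p w′ t<L′ w′≡p

[2m+n]%4≡2[m%2]+n : ∀ m {n} → n < 2 → (2 * m + n) % 4 ≡ 2 * (m % 2) + n
[2m+n]%4≡2[m%2]+n m {n} n<2 = begin
  (2 * m + n) % 4                     ≡⟨ cong (λ r → (2 * r + n) % 4) (m≡m%n+[m/n]*n m 2) ⟩
  (2 * (m % 2 + m / 2 * 2) + n) % 4   ≡⟨ cong (_% 4) (regroup (m % 2) (m / 2) n) ⟩
  (2 * (m % 2) + n + m / 2 * 4) % 4   ≡⟨ [m+kn]%n≡m%n (2 * (m % 2) + n) (m / 2) 4 ⟩
  (2 * (m % 2) + n) % 4               ≡⟨ m<n⇒m%n≡m (+-mono-≤-< (*-monoʳ-≤ 2 (≤-pred (m%n<n m 2))) n<2) ⟩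
  2 * (m % 2) + n                     ∎
  where
    regroup : ∀ r q n → 2 * (r + q * 2) + n ≡ 2 * r + n + q * 4
    regroup = solve-∀

overlap-residue : ∀ t a b → (a + b) % 4 < 2 →
                  ((t + a) % 4 + (t + b) % 4) % 4 ≡ 2 * (t % 2) + (a + b) % 4
overlap-residue t a b s<2 = begin
  ((t + a) % 4 + (t + b) % 4) % 4 ≡⟨ %-distribˡ-+ (t + a) (t + b) 4 ⟨
  (t + a + (t + b)) % 4           ≡⟨ cong (_% 4) (regroup t a b) ⟩
  (2 * t + (a + b)) % 4           ≡⟨ [m+n%o]%o≡[m+n]%o (2 * t) (a + b) 4 ⟨
  (2 * t + (a + b) % 4) % 4       ≡⟨ [2m+n]%4≡2[m%2]+n t s<2 ⟩
  2 * (t % 2) + (a + b) % 4       ∎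
  where
    regroup : ∀ x y z → x + y + (x + z) ≡ 2 * x + (y + z)
    regroup = solve-∀

2m+n<2⇒m≡0 : ∀ {m n} → m < 2 → 2 * m + n < 2 → m ≡ 0
2m+n<2⇒m≡0 {0} _ _ = refl
2m+n<2⇒m≡0 {1} _ (s≤s (s≤s ()))
2m+n<2⇒m≡0 {suc (suc _)} (s≤s (s≤s ())) _

2m+n≡2⇒m≡1 : ∀ {m n} → m < 2 → n < 2 → 2 * m + n ≡ 2 → m ≡ 1
2m+n≡2⇒m≡1 {0} _ (s≤s (s≤s ())) refl
2m+n≡2⇒m≡1 {1} _ _ _ = refl
2m+n≡2⇒m≡1 {suc (suc _)} (s≤s (s≤s ())) _ _

overlap-parity : ∀ t a b {L L′} → L ≡ t + a → L′ ≡ t + b → (a + b) % 4 < 2 →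
  ((L % 4 ≡ 0 × L′ % 4 ≡ 0) ⊎ (L % 4 ≡ 0 × L′ % 4 ≡ 1) ⊎ (L % 4 ≡ 1 × L′ % 4 ≡ 0) → t % 2 ≡ 0)
  × (L % 4 ≡ 1 × L′ % 4 ≡ 1 → t % 2 ≡ 1)
overlap-parity t a b refl refl s<2 = even , odd
  where
    residue : ∀ {i j} → (t + a) % 4 ≡ i → (t + b) % 4 ≡ j → (i + j) % 4 ≡ 2 * (t % 2) + (a + b) % 4
    residue refl refl = overlap-residue t a b s<2

    even-if : ∀ {i j} → (i + j) % 4 < 2 → (t + a) % 4 ≡ i → (t + b) % 4 ≡ j → t % 2 ≡ 0
    even-if i+j<2 eᵢ eⱼ = 2m+n<2⇒m≡0 (m%n<n t 2) (subst (_< 2) (residue eᵢ eⱼ) i+j<2)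

    even : ((t + a) % 4 ≡ 0 × (t + b) % 4 ≡ 0) ⊎ ((t + a) % 4 ≡ 0 × (t + b) % 4 ≡ 1)
           ⊎ ((t + a) % 4 ≡ 1 × (t + b) % 4 ≡ 0) → t % 2 ≡ 0
    even (inj₁ (eᵢ , eⱼ))        = even-if (s≤s z≤n) eᵢ eⱼ
    even (inj₂ (inj₁ (eᵢ , eⱼ))) = even-if (s≤s (s≤s z≤n)) eᵢ eⱼ
    even (inj₂ (inj₂ (eᵢ , eⱼ))) = even-if (s≤s (s≤s z≤n)) eᵢ eⱼ

    odd : (t + a) % 4 ≡ 1 × (t + b) % 4 ≡ 1 → t % 2 ≡ 1
    odd (eᵢ , eⱼ) = 2m+n≡2⇒m≡1 (m%n<n t 2) s<2 (sym (residue eᵢ eⱼ))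

clamp : ∀ t → ℕ → Fin (suc t)
clamp t       zero    = fzero
clamp zero    (suc k) = fzero
clamp (suc t) (suc k) = fsuc (clamp t k)

toℕ-clamp : ∀ {t k} → k ≤ t → toℕ (clamp t k) ≡ k
toℕ-clamp {t}     {zero}  _         = refl
toℕ-clamp {suc t} {suc k} (s≤s k≤t) = cong suc (toℕ-clamp k≤t)

clamp-toℕ : ∀ {t k} (i : Fin (suc t)) → toℕ i ≡ k → clamp t k ≡ i
clamp-toℕ i refl = toℕ-injective (toℕ-clamp (≤-pred (toℕ<n i)))

module _ {n : ℕ} {G : Graph n} where

  intersection-path : ∀ (C C′ : Cycle G) t → IntersectionIsPath G C C′ t → PathIntersection C C′ t
  intersection-path C C′ t (q , q-injective , covered , _ , edge-covered , edge-on-both) = record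
    { path          = record { vertex = p ; injective = p-injective ; step = p-step }
    ; common-vertex = common-vertex
    ; common-edge   = common-edge
    }
    where
      p : ℕ → Fin n
      p = q ∘ clamp t

      p-at : ∀ {k} (i : Fin (suc t)) → toℕ i ≡ k → p k ≡ q i
      p-at i e = cong q (clamp-toℕ i e)

      p-injective : ∀ {i j} → i ≤ t → j ≤ t → p i ≡ p j → i ≡ j
      p-injective i≤t j≤t e = trans (sym (toℕ-clamp i≤t)) (trans (cong toℕ (q-injective e)) (toℕ-clamp j≤t))

      p-step : ∀ {k} → k < t → OnE C (p k) (p (suc k)) × OnE C′ (p k) (p (suc k))
      p-step {k} k<t = edge-on-both (p k) (p (suc k)) (fromℕ< k<t , inj₁
        ( sym (p-at (inject₁ (fromℕ< k<t)) (trans (toℕ-inject₁ (fromℕ< k<t)) (toℕ-fromℕ< k<t)))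
        , sym (p-at (fsuc (fromℕ< k<t)) (cong suc (toℕ-fromℕ< k<t)))))

      common-vertex : ∀ {x} → OnV C x → OnV C′ x → ∃ λ i → i ≤ t × p i ≡ x
      common-vertex v v′ with covered _ (v , v′)
      ... | i , qᵢ≡x = toℕ i , ≤-pred (toℕ<n i) , trans (p-at i refl) qᵢ≡x

      common-edge : ∀ {x y} → OnE C x y → OnE C′ x y → ∃ λ i → i < t × SameEnds (p i) (p (suc i)) x y
      common-edge e e′ with edge-covered _ _ (e , e′)
      ... | i , s = toℕ i , toℕ<n i ,
        SameEnds-cong (sym (p-at (inject₁ i) (toℕ-inject₁ i))) (sym (p-at (fsuc i) refl)) s

n≡0∨n≡1⇒n<2 : ∀ {r} → r ≡ 0 ⊎ r ≡ 1 → r < 2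
n≡0∨n≡1⇒n<2 (inj₁ refl) = s≤s z≤n
n≡0∨n≡1⇒n<2 (inj₂ refl) = s≤s (s≤s z≤n)

theorem3 : ∀ {n} (G : Graph n) → Eps01 G →
    (C C' : Cycle G) (t : ℕ) → 0 < t → IntersectionIsPath G C C' t →
    ((OfType G 0 C × OfType G 0 C') ⊎ (OfType G 0 C × OfType G 1 C') ⊎ (OfType G 1 C × OfType G 0 C')
      → t % 2 ≡ 0)
    × (OfType G 1 C × OfType G 1 C' → t % 2 ≡ 1)
theorem3 G (_ , cycles-of-type-01 , _ , _) C C′ t 0<t intersection =
  let a , b , |C|≡t+a , |C′|≡t+b , D , |D|≡a+b =
        complementary-cycle 0<t (intersection-path C C′ t intersection)
  in  overlap-parity t a b |C|≡t+a |C′|≡t+b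
        (subst (λ ℓ → ℓ % 4 < 2) |D|≡a+b (n≡0∨n≡1⇒n<2 (cycles-of-type-01 D)))
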